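{- Let $(T;<)$ be a tree. For a family $\mathcal{Y}$ of subsets of $T$, let $\mathcal{C}(\mathcal{Y})$ be the set of all $C$ such that, for some $\mathsf{S}\in\mathcal{Y}$, $C$ is a $<$-component without root of the forest $T^{\geqslant\mathsf{S}}$; for each $C\in\mathcal{C}(\mathcal{Y})$ let $t_C$ be a new element not in $T$ (distinct for distinct $C$). Define $T^{\mathcal{Y}}:=T\cup\{t_C:C\in\mathcal{C}(\mathcal{Y})\}$ and the relation $<^{\mathcal{Y}}$ on it consisting of: all $(x,y)\in T\times T$ with $x<y$; all $(t_C,t_D)$ with $C,D\in\mathcal{C}(\mathcal{Y})$, $D\subsetneq C$; all $(u,t_C)$ with $C\in\mathcal{C}(\mathcal{Y})$ and $u\in T$ a lower bound of $C$; all $(t_C,u)$ with $C\in\mathcal{C}(\mathcal{Y})$, $u\in C$. Let $\mathcal{S}'$ be the set of all stems of $T$ and $\mathcal{T}'$ the set of all finitely generated trunks of $T$. Then (1) $(T^{\mathcal{S}'};<^{\mathcal{S}'})$ is a pathwise complete tree containing $(T;<)$ as a substructure; (2) $(T^{\mathcal{T}'};<^{\mathcal{T}'})$ is a weakly branching complete tree containing $(T;<)$ as a substructure.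
   Context: A forest is a partial order in which $\{y:y<x\}$ is linearly ordered for every $x$; a tree is a forest in which any two elements have a common lower bound (no well-foundedness or root assumed). A path is a maximal linearly ordered set of nodes. $T^{\geqslant\mathsf{S}}=\{t\in T:t\geqslant s\text{ for all }s\in\mathsf{S}\}$ with induced order. A $<$-component of a forest $(F;<)$ is a non-empty $C\subseteq F$ such that (i) if $t\in C$, $t'\leqslant t$ and $t'\leqslant u$ (with $t',u\in F$) then $u\in C$, and (ii) $C$ is minimal by inclusion with (i); a root of $C$ is a least element of $C$. Stem: non-empty downward-closed chain bounded above. Bridge: non-empty convex chain $\mathsf{J}$ with, for each path $\mathsf{P}$, $\mathsf{J}\subseteq\mathsf{P}$ or $\mathsf{J}\cap\mathsf{P}=\emptyset$; $[t]$ is the maximal bridge containing $t$. Trunk: stem $\mathsf{A}$ with $\mathsf{A}=\bigcup_{t\in\mathsf{A}}[t]$; finitely generated trunk: trunk equal to $\mathsf{P}\cap\mathsf{Q}$ for some paths. Pathwise complete: for every path $\mathsf{P}$ and non-empty $X\subseteq\mathsf{P}$ bounded below, $X$ has an infimum in $\mathsf{P}$. Weakly branching complete: for any distinct paths $\mathsf{P},\mathsf{Q}$, $\mathsf{P}\cap\mathsf{Q}$ has a supremum in $\mathsf{P}$ and in $\mathsf{Q}$. -}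

module Defs where

open import Level using (Level; _⊔_; suc)
open import Data.Product using (Σ; ∃; ∃₂; _×_; _,_)
open import Data.Sum using (_⊎_; inj₁; inj₂)
open import Data.Empty using (⊥)
open import Relation.Nullary using (¬_)
open import Relation.Unary using (Pred; _⊆_; _∩_; Satisfiable; Empty)
open import Relation.Binary.Core using (Rel)
open import Relation.Binary.Structures using (IsStrictPartialOrder)
open import Relation.Binary.PropositionalEquality using (_≡_)

module Order {a ℓ₁ ℓ₂ : Level} {X : Set a} (_≈_ : Rel X ℓ₁) (_<_ : Rel X ℓ₂) where

  _≤_ : Rel X (ℓ₁ ⊔ ℓ₂)
  x ≤ y = x < y ⊎ x ≈ y

  Comparable : Rel X (ℓ₁ ⊔ ℓ₂)
  Comparable x y = x < y ⊎ x ≈ y ⊎ y < x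

  IsForest : Set (a ⊔ ℓ₁ ⊔ ℓ₂)
  IsForest = IsStrictPartialOrder _≈_ _<_
           × (∀ x y z → y < x → z < x → Comparable y z)

  IsTree : Set (a ⊔ ℓ₁ ⊔ ℓ₂)
  IsTree = IsForest × (∀ x y → ∃ λ z → z ≤ x × z ≤ y)

  IsChain : Pred X a → Set (a ⊔ ℓ₁ ⊔ ℓ₂)
  IsChain P = ∀ {x y} → P x → P y → Comparable x y

  IsPath : Pred X a → Set (suc a ⊔ ℓ₁ ⊔ ℓ₂)
  IsPath P = IsChain P × (∀ (Q : Pred X a) → IsChain Q → P ⊆ Q → Q ⊆ P)

  LowerBound : Pred X a → X → Set (a ⊔ ℓ₁ ⊔ ℓ₂)
  LowerBound A m = ∀ {x} → A x → m ≤ x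

  UpperBound : Pred X a → X → Set (a ⊔ ℓ₁ ⊔ ℓ₂)
  UpperBound A m = ∀ {x} → A x → x ≤ m

  BoundedBelow : Pred X a → Set (a ⊔ ℓ₁ ⊔ ℓ₂)
  BoundedBelow A = ∃ λ b → LowerBound A b

  BoundedAbove : Pred X a → Set (a ⊔ ℓ₁ ⊔ ℓ₂)
  BoundedAbove A = ∃ λ b → UpperBound A b

  IsInfimumIn : Pred X a → Pred X a → X → Set (a ⊔ ℓ₁ ⊔ ℓ₂)
  IsInfimumIn P A m = P m × LowerBound A m
                    × (∀ {m'} → P m' → LowerBound A m' → m' ≤ m)

  IsSupremumIn : Pred X a → Pred X a → X → Set (a ⊔ ℓ₁ ⊔ ℓ₂)
  IsSupremumIn P A m = P m × UpperBound A m
                     × (∀ {m'} → P m' → UpperBound A m' → m ≤ m')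

  PathwiseComplete : Set (suc a ⊔ ℓ₁ ⊔ ℓ₂)
  PathwiseComplete = ∀ (P : Pred X a) → IsPath P →
    ∀ (A : Pred X a) → A ⊆ P → Satisfiable A → BoundedBelow A →
    ∃ λ m → IsInfimumIn P A m

  WeaklyBranchingComplete : Set (suc a ⊔ ℓ₁ ⊔ ℓ₂)
  WeaklyBranchingComplete = ∀ (P Q : Pred X a) → IsPath P → IsPath Q →
    ¬ (P ⊆ Q × Q ⊆ P) →
    (∃ λ m → IsSupremumIn P (P ∩ Q) m) × (∃ λ m → IsSupremumIn Q (P ∩ Q) m)

IsSubstructureVia : {a b ℓ₁ ℓ₂ : Level} {T : Set a} {X : Set b}
  (_<_ : Rel T a) (_≈'_ : Rel X ℓ₁) (_<'_ : Rel X ℓ₂) (e : T → X) →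
  Set (a ⊔ ℓ₁ ⊔ ℓ₂)
IsSubstructureVia _<_ _≈'_ _<'_ e =
  (∀ x y → e x ≈' e y → x ≡ y)
  × (∀ x y → (x < y → e x <' e y) × (e x <' e y → x < y))

module TreeNotions {a : Level} {T : Set a} (_<_ : Rel T a) where

  open Order {X = T} _≡_ _<_ public

  Above : Pred T a → Pred T a
  Above S t = ∀ {s} → S s → s ≤ t

  Closed : Pred T a → Pred T a → Set a
  Closed F C = ∀ {t t' u} → C t → F t' → F u → t' ≤ t → t' ≤ u → C u

  IsComponent : Pred T a → Pred T a → Set (suc a)
  IsComponent F C = C ⊆ F × Satisfiable C × Closed F C
    × (∀ (D : Pred T a) → D ⊆ F → Satisfiable D → Closed F D → D ⊆ C → C ⊆ D)

  IsRoot : Pred T a → T → Set a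
  IsRoot C r = C r × (∀ {c} → C c → r ≤ c)

  RootlessComponent : Pred T a → Pred T a → Set (suc a)
  RootlessComponent S C = IsComponent (Above S) C × ¬ (∃ λ r → IsRoot C r)

  DownClosed : Pred T a → Set a
  DownClosed S = ∀ {x y} → S y → x ≤ y → S x

  Convex : Pred T a → Set a
  Convex J = ∀ {x y z} → J x → J z → x ≤ y → y ≤ z → J y

  IsStem : Pred T a → Set a
  IsStem S = Satisfiable S × DownClosed S × IsChain S × BoundedAbove S

  IsBridge : Pred T a → Set (suc a)
  IsBridge J = Satisfiable J × Convex J × IsChain J
    × (∀ (P : Pred T a) → IsPath P → J ⊆ P ⊎ Empty (J ∩ P))

  IsMaxBridgeAt : T → Pred T a → Set (suc a)
  IsMaxBridgeAt t M = IsBridge M × M t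
    × (∀ (J : Pred T a) → IsBridge J → J t → M ⊆ J → J ⊆ M)

  InBracket : T → T → Set (suc a)
  InBracket t x = ∃ λ M → IsMaxBridgeAt t M × M x

  IsTrunk : Pred T a → Set (suc a)
  IsTrunk A = IsStem A
    × (∀ x → (A x → ∃ λ t → A t × InBracket t x)
           × ((∃ λ t → A t × InBracket t x) → A x))

  IsFGTrunk : Pred T a → Set (suc a)
  IsFGTrunk A = IsTrunk A × ∃₂ λ P Q → IsPath P × IsPath Q
    × (∀ x → (A x → P x × Q x) × (P x × Q x → A x))

-- The extension (T^𝒴 ; <^𝒴) for a family 𝒴 of subsets of T.
-- New points t_C are indexed by pairs (C , proof C ∈ 𝒞(𝒴)); two new
-- points are identified (via _≈Y_) iff their sets C coincide.

module Extension {a b : Level} {T : Set a} (_<_ : Rel T a)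
                 (𝒴 : Pred (Pred T a) b) where

  open TreeNotions _<_

  In𝒞 : Pred (Pred T a) (suc a ⊔ b)
  In𝒞 C = ∃ λ S → 𝒴 S × RootlessComponent S C

  Carrier : Set (suc a ⊔ b)
  Carrier = T ⊎ Σ (Pred T a) In𝒞

  embed : T → Carrier
  embed = inj₁

  _≈Y_ : Rel Carrier a
  inj₁ x ≈Y inj₁ y = x ≡ y
  inj₁ x ≈Y inj₂ D = Level.Lift a ⊥
  inj₂ C ≈Y inj₁ y = Level.Lift a ⊥
  inj₂ (C , _) ≈Y inj₂ (D , _) = C ⊆ D × D ⊆ C

  _<Y_ : Rel Carrier a
  inj₁ x <Y inj₁ y = x < y
  inj₁ u <Y inj₂ (C , _) = ∀ {c} → C c → u ≤ c
  inj₂ (C , _) <Y inj₁ u = C u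
  inj₂ (C , _) <Y inj₂ (D , _) = D ⊆ C × ¬ (C ⊆ D)

{-# OPTIONS --safe #-}
module Submission where

-- Given a path P of the extension and A ⊆ P bounded below, the old lower bounds
-- L of A form a stem, and the infimum of A is the root of the component of
-- T^{≥L} above A, or the new point of that component if it has no root.  For
-- distinct paths P and Q without a greatest common point, the old points of
-- P ∩ Q are the intersection of two paths of T, hence a finitely generated
-- trunk, and the same construction with the component containing P ∖ Q yields
-- the supremum of P ∩ Q.

open import Defs
open import Level using (Level; Lift; lift; _⊔_) renaming (suc to lsuc)
open import Function using (id)
open import Data.Product using (∃; _×_; _,_; proj₁; proj₂; swap)
open import Data.Sum using (_⊎_; inj₁; inj₂)
open import Data.Empty using (⊥-elim)
open import Relation.Nullary using (¬_; yes; no)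
open import Relation.Nullary.Decidable using (True; toWitness; fromWitness; decidable-stable)
open import Relation.Unary using (Pred; _⊆_; _∩_; ｛_｝; Satisfiable; Empty)
open import Relation.Binary.Core using (Rel)
open import Relation.Binary.Structures using (IsStrictPartialOrder; IsPartialOrder; IsEquivalence)
open import Relation.Binary.PropositionalEquality using (_≡_; refl; sym)
open import Axiom.ExcludedMiddle using (ExcludedMiddle)
import Relation.Binary.Construct.StrictToNonStrict as StrictToNonStrict

module Classical (em : ∀ {ℓ} → ExcludedMiddle ℓ) where

  -- With excluded middle every proposition has a copy at any level; this is
  -- needed to turn predicates on the extension into predicates on T.
  Resize : ∀ {ℓ} ℓ' → Set ℓ → Set ℓ'
  Resize ℓ' P = Lift ℓ' (True (em {P = P}))

  resize : ∀ {ℓ ℓ'} {P : Set ℓ} → P → Resize ℓ' P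
  resize p = lift (fromWitness p)

  unresize : ∀ {ℓ ℓ'} {P : Set ℓ} → Resize ℓ' P → P
  unresize (lift w) = toWitness w

  dne : ∀ {ℓ} {P : Set ℓ} → ¬ ¬ P → P
  dne = decidable-stable em

  ¬⊆⇒∃ : ∀ {ℓ ℓ₁ ℓ₂} {A : Set ℓ} {P : Pred A ℓ₁} {Q : Pred A ℓ₂} →
         ¬ (P ⊆ Q) → ∃ λ x → P x × ¬ Q x
  ¬⊆⇒∃ ¬P⊆Q = dne λ ¬∃ → ¬P⊆Q λ {x} Px → dne λ ¬Qx → ¬∃ (x , Px , ¬Qx)

module ForestProperties {ℓ x : Level} {X : Set (ℓ ⊔ x)} (_≈_ _<_ : Rel X ℓ)
                        (forest : Order.IsForest _≈_ _<_) where

  open Order _≈_ _<_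
  open IsStrictPartialOrder (proj₁ forest) public renaming (trans to <-trans)
  open IsPartialOrder (StrictToNonStrict.isPartialOrder _≈_ _<_ (proj₁ forest)) public
    using () renaming (refl to ≤-refl; trans to ≤-trans)

  <-≤-trans : ∀ {x y z} → x < y → y ≤ z → x < z
  <-≤-trans = StrictToNonStrict.<-≤-trans _≈_ _<_ <-trans <-respʳ-≈

  ≤-<-trans : ∀ {x y z} → x ≤ y → y < z → x < z
  ≤-<-trans = StrictToNonStrict.≤-<-trans _≈_ _<_ Eq.sym <-trans <-respˡ-≈

  ≤⇒≯ : ∀ {x y} → x ≤ y → ¬ (y < x)
  ≤⇒≯ x≤y y<x = irrefl Eq.refl (≤-<-trans x≤y y<x)

  Comparable-sym : ∀ {x y} → Comparable x y → Comparable y x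
  Comparable-sym (inj₁ x<y)       = inj₂ (inj₂ x<y)
  Comparable-sym (inj₂ (inj₁ x≈y)) = inj₂ (inj₁ (Eq.sym x≈y))
  Comparable-sym (inj₂ (inj₂ y<x)) = inj₁ y<x

  Comparable-respʳ : ∀ {x y z} → Comparable x y → y ≈ z → Comparable x z
  Comparable-respʳ (inj₁ x<y)       y≈z = inj₁ (<-respʳ-≈ y≈z x<y)
  Comparable-respʳ (inj₂ (inj₁ x≈y)) y≈z = inj₂ (inj₁ (Eq.trans x≈y y≈z))
  Comparable-respʳ (inj₂ (inj₂ y<x)) y≈z = inj₂ (inj₂ (<-respˡ-≈ y≈z y<x))

  Comparable⇒≤⊎> : ∀ {x y} → Comparable x y → x ≤ y ⊎ y < x
  Comparable⇒≤⊎> (inj₁ x<y)       = inj₁ (inj₁ x<y)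
  Comparable⇒≤⊎> (inj₂ (inj₁ x≈y)) = inj₁ (inj₂ x≈y)
  Comparable⇒≤⊎> (inj₂ (inj₂ y<x)) = inj₂ y<x

  Comparable⇒≤⊎≥ : ∀ {x y} → Comparable x y → x ≤ y ⊎ y ≤ x
  Comparable⇒≤⊎≥ c with Comparable⇒≤⊎> c
  ... | inj₁ x≤y = inj₁ x≤y
  ... | inj₂ y<x = inj₂ (inj₁ y<x)

  ≤-below-comparable : ∀ {x y z} → y ≤ x → z ≤ x → Comparable y z
  ≤-below-comparable {x} (inj₁ y<x) (inj₁ z<x) = proj₂ forest x _ _ y<x z<x
  ≤-below-comparable (inj₁ y<x) (inj₂ z≈x) = inj₁ (<-respʳ-≈ (Eq.sym z≈x) y<x)
  ≤-below-comparable (inj₂ y≈x) (inj₁ z<x) = inj₂ (inj₂ (<-respʳ-≈ (Eq.sym y≈x) z<x))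
  ≤-below-comparable (inj₂ y≈x) (inj₂ z≈x) = inj₂ (inj₁ (Eq.trans y≈x (Eq.sym z≈x)))

  module _ {P : Pred X (ℓ ⊔ x)} (path : IsPath P) where

    path-comparable : ∀ {y z} → P y → P z → Comparable y z
    path-comparable = proj₁ path

    path-maximal : ∀ {y} → (∀ {z} → P z → Comparable z y) → P y
    path-maximal {y} comparable = proj₂ path (λ z → P z ⊎ z ≈ y) chain inj₁ (inj₂ Eq.refl)
      where
      chain : IsChain (λ z → P z ⊎ z ≈ y)
      chain (inj₁ Pz) (inj₁ Pw)  = path-comparable Pz Pw
      chain (inj₁ Pz) (inj₂ w≈y) = Comparable-respʳ (comparable Pz) (Eq.sym w≈y)
      chain (inj₂ z≈y) (inj₁ Pw) = Comparable-sym (Comparable-respʳ (comparable Pw) (Eq.sym z≈y))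
      chain (inj₂ z≈y) (inj₂ w≈y) = inj₂ (inj₁ (Eq.trans z≈y (Eq.sym w≈y)))

    path-downClosed : ∀ {y z} → P y → z ≤ y → P z
    path-downClosed {y} {z} Py z≤y = path-maximal comparable
      where
      comparable : ∀ {w} → P w → Comparable w z
      comparable Pw with Comparable⇒≤⊎> (path-comparable Pw Py)
      ... | inj₁ w≤y = ≤-below-comparable w≤y z≤y
      ... | inj₂ y<w = inj₂ (inj₂ (≤-<-trans z≤y y<w))

module TreeProperties (em : ∀ {ℓ} → ExcludedMiddle ℓ)
                      {a : Level} {T : Set a} (_<_ : Rel T a) (tree : Order.IsTree _≡_ _<_) where

  open Classical em
  open TreeNotions _<_ public
  open ForestProperties {ℓ = a} {x = a} _≡_ _<_ (proj₁ tree) public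

  ComponentOf : Pred T a → T → Pred T a
  ComponentOf F c u = F u × ∃ λ w → F w × w ≤ u × w ≤ c

  componentOf-closed : ∀ F c → Closed F (ComponentOf F c)
  componentOf-closed F c (Ft , w , Fw , w≤t , w≤c) Ft' Fu t'≤t t'≤u
    with Comparable⇒≤⊎> (≤-below-comparable w≤t t'≤t)
  ... | inj₁ w≤t' = Fu , w , Fw , ≤-trans w≤t' t'≤u , w≤c
  ... | inj₂ t'<w = Fu , _ , Ft' , t'≤u , inj₁ (<-≤-trans t'<w w≤c)

  componentOf-∋ : ∀ {F c} → F c → ComponentOf F c c
  componentOf-∋ Fc = Fc , _ , Fc , ≤-refl , ≤-refl

  componentOf-isComponent : ∀ {F c} → F c → IsComponent F (ComponentOf F c)
  componentOf-isComponent {F} {c} Fc =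
    proj₁ , (c , componentOf-∋ Fc) , componentOf-closed F c , minimal
    where
    minimal : ∀ D → D ⊆ F → Satisfiable D → Closed F D → D ⊆ ComponentOf F c → ComponentOf F c ⊆ D
    minimal D _ (d , Dd) closedD D⊆ (Fu , w , Fw , w≤u , w≤c) with D⊆ Dd
    ... | (_ , w' , Fw' , w'≤d , w'≤c) = closedD (closedD Dd Fw' Fc w'≤d w'≤c) Fw Fu w≤c w≤u

  component-connected : ∀ {F C} → IsComponent F C → ∀ {x y} → C x → C y →
                        ∃ λ w → F w × w ≤ x × w ≤ y
  component-connected {F} (C⊆F , _ , closedC , minimal) {x} Cx Cy
    with minimal (ComponentOf F x) proj₁ (x , componentOf-∋ (C⊆F Cx)) (componentOf-closed F x)
                 (λ { (Fu , w , Fw , w≤u , w≤x) → closedC Cx Fw Fu w≤x w≤u }) Cy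
  ... | (_ , w , Fw , w≤y , w≤x) = w , Fw , w≤x , w≤y

  component-⊆ : ∀ {F G C D} → IsComponent F C → IsComponent G D → F ⊆ G →
                ∀ {x} → C x → D x → C ⊆ D
  component-⊆ componentC (_ , _ , closedD , _) F⊆G Cx Dx Cy
    with component-connected componentC Cx Cy
  ... | (w , Fw , w≤x , w≤y) = closedD Dx (F⊆G Fw) (F⊆G (proj₁ componentC Cy)) w≤x w≤y

  Above-antitone : ∀ {S S'} → S ⊆ S' → Above S' ⊆ Above S
  Above-antitone S⊆S' aboveS' Ss = aboveS' (S⊆S' Ss)

  component-upClosed : ∀ {S C} → IsComponent (Above S) C → ∀ {u v} → C u → u ≤ v → C v
  component-upClosed (C⊆F , _ , closedC , _) Cu u≤v =
    closedC Cu (C⊆F Cu) (λ Ss → ≤-trans (C⊆F Cu Ss) u≤v) ≤-refl u≤v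

  downClosed-⊆-total : ∀ {S S'} → DownClosed S → DownClosed S' → ∀ {c} → Above S c → Above S' c →
                       S ⊆ S' ⊎ S' ⊆ S
  downClosed-⊆-total {S} {S'} downS downS' aboveS aboveS' with em {P = S ⊆ S'}
  ... | yes S⊆S' = inj₁ S⊆S'
  ... | no S⊈S' with ¬⊆⇒∃ S⊈S'
  ...   | (s , Ss , ¬S's) = inj₂ S'⊆S
    where
    S'⊆S : S' ⊆ S
    S'⊆S S's' with Comparable⇒≤⊎> (≤-below-comparable (aboveS Ss) (aboveS' S's'))
    ... | inj₁ s≤s' = ⊥-elim (¬S's (downS' S's' s≤s'))
    ... | inj₂ s'<s = downS Ss (inj₁ s'<s)

  downClosed-boundedAbove-isStem : ∀ {S c} → Satisfiable S → DownClosed S → Above S c → IsStem S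
  downClosed-boundedAbove-isStem nonEmpty downClosed S≤c =
    nonEmpty , downClosed , (λ Sx Sy → ≤-below-comparable (S≤c Sx) (S≤c Sy)) , _ , S≤c

  above-or-below : ∀ {S u} → (∀ {s} → S s → Comparable s u) → Above S u ⊎ ∃ λ s → S s × u < s
  above-or-below {S} {u} comparable with em {P = Above S u}
  ... | yes aboveS = inj₁ aboveS
  ... | no ¬aboveS with ¬⊆⇒∃ {Q = _≤ u} ¬aboveS
  ...   | (s , Ss , s≰u) with Comparable⇒≤⊎> (comparable Ss)
  ...     | inj₁ s≤u = ⊥-elim (s≰u s≤u)
  ...     | inj₂ u<s = inj₂ (s , Ss , u<s)

  component-∋-or-lowerBound : ∀ {S D} → IsComponent (Above S) D → ∀ {c u} → D c → u ≤ c →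
                              D u ⊎ (∀ {d} → D d → u ≤ d)
  component-∋-or-lowerBound (D⊆F , _ , closedD , _) Dc u≤c
    with above-or-below (λ Ss → ≤-below-comparable (D⊆F Dc Ss) u≤c)
  ... | inj₁ aboveS = inj₁ (closedD Dc aboveS aboveS u≤c ≤-refl)
  ... | inj₂ (s , Ss , u<s) = inj₂ λ Dd → inj₁ (<-≤-trans u<s (D⊆F Dd Ss))

  singleton-isBridge : ∀ t → IsBridge ｛ t ｝
  singleton-isBridge t = (t , refl) , convex , chain , pathwise
    where
    convex : Convex ｛ t ｝
    convex refl refl (inj₂ t≡y) _           = t≡y
    convex refl refl (inj₁ _)   (inj₂ y≡t)  = sym y≡t
    convex refl refl (inj₁ t<y) (inj₁ y<t)  = ⊥-elim (asym t<y y<t)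
    chain : IsChain ｛ t ｝
    chain refl refl = inj₂ (inj₁ refl)
    pathwise : ∀ P → IsPath P → ｛ t ｝ ⊆ P ⊎ Empty (｛ t ｝ ∩ P)
    pathwise P _ with em {P = P t}
    ... | yes Pt = inj₁ λ { refl → Pt }
    ... | no ¬Pt = inj₂ λ { _ (refl , Pt) → ¬Pt Pt }

  bridge-⊆-path : ∀ {J P t} → IsBridge J → IsPath P → J t → P t → J ⊆ P
  bridge-⊆-path {J} {P} {t} (_ , _ , _ , pathwise) path Jt Pt with pathwise P path
  ... | inj₁ J⊆P   = J⊆P
  ... | inj₂ empty = ⊥-elim (empty t (Jt , Pt))

  MaxBridge : T → Pred T a
  MaxBridge t x = Resize a (∃ λ J → IsBridge J × J t × J x)

  maxBridge-isMaxBridgeAt : ∀ {R t} → IsPath R → R t → IsMaxBridgeAt t (MaxBridge t)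
  maxBridge-isMaxBridgeAt {R} {t} pathR Rt =
    ((t , ∋t) , convex , chain , pathwise) , ∋t , λ J bridgeJ Jt _ Jx → resize (J , bridgeJ , Jt , Jx)
    where
    ∋t : MaxBridge t t
    ∋t = resize (｛ t ｝ , singleton-isBridge t , refl , refl)
    ⊆R : ∀ {x} → MaxBridge t x → R x
    ⊆R Mx with unresize Mx
    ... | (J , bridgeJ , Jt , Jx) = bridge-⊆-path bridgeJ pathR Jt Rt Jx
    convex : Convex (MaxBridge t)
    convex Mx Mz x≤y y≤z with unresize Mx | unresize Mz
    ... | (J , bridgeJ , Jt , Jx) | (K , bridgeK , Kt , Kz)
      with Comparable⇒≤⊎≥ (path-comparable pathR (path-downClosed pathR (⊆R Mz) y≤z) Rt)
    ...   | inj₁ y≤t = resize (J , bridgeJ , Jt , proj₁ (proj₂ bridgeJ) Jx Jt x≤y y≤t)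
    ...   | inj₂ t≤y = resize (K , bridgeK , Kt , proj₁ (proj₂ bridgeK) Kt Kz t≤y y≤z)
    chain : IsChain (MaxBridge t)
    chain Mx My = path-comparable pathR (⊆R Mx) (⊆R My)
    pathwise : ∀ P → IsPath P → MaxBridge t ⊆ P ⊎ Empty (MaxBridge t ∩ P)
    pathwise P pathP with em {P = P t}
    ... | yes Pt = inj₁ λ Mx → let (J , bridgeJ , Jt , Jx) = unresize Mx in
                                 bridge-⊆-path bridgeJ pathP Jt Pt Jx
    ... | no ¬Pt = inj₂ λ x (Mx , Px) → let (J , bridgeJ , Jt , Jx) = unresize Mx in
                                          ¬Pt (bridge-⊆-path bridgeJ pathP Jx Px Jt)

  -- Each x ∈ L generates [x] ⊆ L, since a bridge meeting a path lies on it.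
  pathIntersectionStem-isFGTrunk : ∀ {P Q L} → IsPath P → IsPath Q →
    (∀ x → (L x → P x × Q x) × (P x × Q x → L x)) → IsStem L → IsFGTrunk L
  pathIntersectionStem-isFGTrunk {P} {Q} {L} pathP pathQ L≐P∩Q stemL =
    (stemL , λ x → bracket x , unbracket x) , P , Q , pathP , pathQ , L≐P∩Q
    where
    bracket : ∀ x → L x → ∃ λ t → L t × InBracket t x
    bracket x Lx = x , Lx , MaxBridge x ,
      maxBridge-isMaxBridgeAt pathP (proj₁ (proj₁ (L≐P∩Q x) Lx)) ,
      resize (｛ x ｝ , singleton-isBridge x , refl , refl)
    unbracket : ∀ x → (∃ λ t → L t × InBracket t x) → L x
    unbracket x (t , Lt , M , (bridgeM , Mt , _) , Mx) with proj₁ (L≐P∩Q t) Lt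
    ... | (Pt , Qt) = proj₂ (L≐P∩Q x)
      (bridge-⊆-path bridgeM pathP Mt Pt Mx , bridge-⊆-path bridgeM pathQ Mt Qt Mx)

module Extended (em : ∀ {ℓ} → ExcludedMiddle ℓ)
                {a : Level} {T : Set a} (_<_ : Rel T a) (tree : Order.IsTree _≡_ _<_)
                {b : Level} (𝒴 : Pred (Pred T a) b)
                (𝒴⊆stems : ∀ {S} → 𝒴 S → TreeNotions.IsStem _<_ S) where

  open Classical em
  open TreeProperties em _<_ tree
  open Extension _<_ 𝒴
  module Y = Order _≈Y_ _<Y_

  pattern old u = inj₁ u
  pattern new C C∈𝒞 = inj₂ (C , C∈𝒞)

  _≤Y_ : Rel Carrier a
  _≤Y_ = Y._≤_

  stemOf : ∀ {C} → In𝒞 C → Pred T a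
  stemOf = proj₁

  stemOf-downClosed : ∀ {C} (C∈𝒞 : In𝒞 C) → DownClosed (stemOf C∈𝒞)
  stemOf-downClosed C∈𝒞 = proj₁ (proj₂ (𝒴⊆stems (proj₁ (proj₂ C∈𝒞))))

  stemOf-nonEmpty : ∀ {C} (C∈𝒞 : In𝒞 C) → Satisfiable (stemOf C∈𝒞)
  stemOf-nonEmpty C∈𝒞 = proj₁ (𝒴⊆stems (proj₁ (proj₂ C∈𝒞)))

  isComponent : ∀ {C} (C∈𝒞 : In𝒞 C) → IsComponent (Above (stemOf C∈𝒞)) C
  isComponent C∈𝒞 = proj₁ (proj₂ (proj₂ C∈𝒞))

  ⊆Above : ∀ {C} (C∈𝒞 : In𝒞 C) → C ⊆ Above (stemOf C∈𝒞)
  ⊆Above C∈𝒞 = proj₁ (isComponent C∈𝒞)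

  closed : ∀ {C} (C∈𝒞 : In𝒞 C) → Closed (Above (stemOf C∈𝒞)) C
  closed C∈𝒞 = proj₁ (proj₂ (proj₂ (isComponent C∈𝒞)))

  nonEmpty : ∀ {C} → In𝒞 C → Satisfiable C
  nonEmpty C∈𝒞 = proj₁ (proj₂ (isComponent C∈𝒞))

  upClosed : ∀ {C} (C∈𝒞 : In𝒞 C) {u v} → C u → u ≤ v → C v
  upClosed C∈𝒞 = component-upClosed (isComponent C∈𝒞)

  lowerBound-∉ : ∀ {C} → In𝒞 C → ∀ {u} → C u → ¬ (∀ {c} → C c → u ≤ c)
  lowerBound-∉ C∈𝒞 Cu lower = proj₂ (proj₂ (proj₂ C∈𝒞)) (_ , Cu , lower)

  stemOf-<Y : ∀ {C} (C∈𝒞 : In𝒞 C) {s} → stemOf C∈𝒞 s → old s <Y new C C∈𝒞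
  stemOf-<Y C∈𝒞 Ss Cc = ⊆Above C∈𝒞 Cc Ss

  -- The extension is a tree

  ≈Y-isEquivalence : IsEquivalence _≈Y_
  ≈Y-isEquivalence = record
    { refl  = λ {x} → reflexive x
    ; sym   = λ {x} {y} → symmetric x y
    ; trans = λ {x} {y} {z} → transitive x y z
    }
    where
    reflexive : ∀ x → x ≈Y x
    reflexive (old _)   = refl
    reflexive (new _ _) = id , id
    symmetric : ∀ x y → x ≈Y y → y ≈Y x
    symmetric (old _)   (old _)   x≡y = sym x≡y
    symmetric (new _ _) (new _ _) C≐D = swap C≐D
    transitive : ∀ x y z → x ≈Y y → y ≈Y z → x ≈Y z
    transitive (old _)   (old _)   (old _)   refl y≡z = y≡z
    transitive (new _ _) (new _ _) (new _ _) (C⊆D , D⊆C) (D⊆E , E⊆D) =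
      (λ Cc → D⊆E (C⊆D Cc)) , (λ Ee → D⊆C (E⊆D Ee))

  <Y-irrefl : ∀ {x y} → x ≈Y y → ¬ (x <Y y)
  <Y-irrefl {old _}   {old _}   x≡y      x<y       = irrefl x≡y x<y
  <Y-irrefl {new _ _} {new _ _} (C⊆D , _) (_ , C⊈D) = C⊈D C⊆D

  <Y-trans : ∀ {x y z} → x <Y y → y <Y z → x <Y z
  <Y-trans {old _} {old _} {old _}   u<v v<w = <-trans u<v v<w
  <Y-trans {old _} {old _} {new _ _} u<v v≤C Cc = inj₁ (<-≤-trans u<v (v≤C Cc))
  <Y-trans {old u} {new C C∈𝒞} {old v} u≤C Cv with u≤C Cv
  ... | inj₁ u<v = u<v
  ... | inj₂ refl = ⊥-elim (lowerBound-∉ C∈𝒞 Cv u≤C)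
  <Y-trans {old _} {new _ _} {new _ _} u≤C (D⊆C , _) Dd = u≤C (D⊆C Dd)
  <Y-trans {new _ C∈𝒞} {old _} {old _} Cu u<v = upClosed C∈𝒞 Cu (inj₁ u<v)
  <Y-trans {new C C∈𝒞} {old _} {new D D∈𝒞} Cu u≤D =
    (λ Dd → upClosed C∈𝒞 Cu (u≤D Dd)) , λ C⊆D → lowerBound-∉ D∈𝒞 (C⊆D Cu) u≤D
  <Y-trans {new _ _} {new _ _} {old _} (D⊆C , _) Du = D⊆C Du
  <Y-trans {new _ _} {new _ _} {new _ _} (D⊆C , C⊈D) (E⊆D , D⊈E) =
    (λ Ee → D⊆C (E⊆D Ee)) , λ C⊆E → C⊈D (λ Cc → E⊆D (C⊆E Cc))

  <Y-respʳ-≈Y : ∀ {x y z} → y ≈Y z → x <Y y → x <Y z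
  <Y-respʳ-≈Y {old _}   {old _}   {old _}   refl u<v = u<v
  <Y-respʳ-≈Y {old _}   {new _ _} {new _ _} (_ , D⊆C) u≤C Dd = u≤C (D⊆C Dd)
  <Y-respʳ-≈Y {new _ _} {old _}   {old _}   refl Xu = Xu
  <Y-respʳ-≈Y {new _ _} {new _ _} {new _ _} (C⊆D , D⊆C) (C⊆X , X⊈C) =
    (λ Dd → C⊆X (D⊆C Dd)) , λ X⊆D → X⊈C (λ Xx → D⊆C (X⊆D Xx))

  <Y-respˡ-≈Y : ∀ {x y z} → y ≈Y z → y <Y x → z <Y x
  <Y-respˡ-≈Y {old _}   {old _}   {old _}   refl u<v = u<v
  <Y-respˡ-≈Y {old _}   {new _ _} {new _ _} (C⊆D , _) Cu = C⊆D Cu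
  <Y-respˡ-≈Y {new _ _} {old _}   {old _}   refl u≤X = u≤X
  <Y-respˡ-≈Y {new _ _} {new _ _} {new _ _} (C⊆D , D⊆C) (X⊆C , C⊈X) =
    (λ Xx → C⊆D (X⊆C Xx)) , λ D⊆X → C⊈X (λ Cc → D⊆X (C⊆D Cc))

  <Y-isStrictPartialOrder : IsStrictPartialOrder _≈Y_ _<Y_
  <Y-isStrictPartialOrder = record
    { isEquivalence = ≈Y-isEquivalence
    ; irrefl        = λ {x} {y} → <Y-irrefl {x} {y}
    ; trans         = λ {x} {y} {z} → <Y-trans {x} {y} {z}
    ; <-resp-≈      = (λ {x} {y} {z} → <Y-respʳ-≈Y {x} {y} {z})
                    , (λ {x} {y} {z} → <Y-respˡ-≈Y {x} {y} {z})
    }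

  comparable-old-new : ∀ {D} (D∈𝒞 : In𝒞 D) {u c} → u ≤ c → D c → Y.Comparable (old u) (new D D∈𝒞)
  comparable-old-new D∈𝒞 u≤c Dc with component-∋-or-lowerBound (isComponent D∈𝒞) Dc u≤c
  ... | inj₁ Du = inj₂ (inj₂ Du)
  ... | inj₂ u≤D = inj₁ u≤D

  comparable-new-old : ∀ {D} (D∈𝒞 : In𝒞 D) {u c} → u ≤ c → D c → Y.Comparable (new D D∈𝒞) (old u)
  comparable-new-old D∈𝒞 u≤c Dc with comparable-old-new D∈𝒞 u≤c Dc
  ... | inj₁ u<D       = inj₂ (inj₂ u<D)
  ... | inj₂ (inj₂ Du) = inj₁ Du

  ⊆⇒≤Y : ∀ {C D} (C∈𝒞 : In𝒞 C) (D∈𝒞 : In𝒞 D) → D ⊆ C → new C C∈𝒞 ≤Y new D D∈𝒞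
  ⊆⇒≤Y {C} {D} _ _ D⊆C with em {P = C ⊆ D}
  ... | yes C⊆D = inj₂ (C⊆D , D⊆C)
  ... | no C⊈D  = inj₁ (D⊆C , C⊈D)

  nested⇒Comparable : ∀ {C D} (C∈𝒞 : In𝒞 C) (D∈𝒞 : In𝒞 D) → C ⊆ D ⊎ D ⊆ C →
                      Y.Comparable (new C C∈𝒞) (new D D∈𝒞)
  nested⇒Comparable {C} {D} _ _ (inj₁ C⊆D) with em {P = D ⊆ C}
  ... | yes D⊆C = inj₂ (inj₁ (C⊆D , D⊆C))
  ... | no D⊈C  = inj₂ (inj₂ (C⊆D , D⊈C))
  nested⇒Comparable {C} {D} _ _ (inj₂ D⊆C) with em {P = C ⊆ D}
  ... | yes C⊆D = inj₂ (inj₁ (C⊆D , D⊆C))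
  ... | no C⊈D  = inj₁ (D⊆C , C⊈D)

  -- Overlapping components of T^{≥S} and T^{≥S'} are nested because the
  -- stems S and S' are.
  comparable-new-new : ∀ {C D} (C∈𝒞 : In𝒞 C) (D∈𝒞 : In𝒞 D) {c} → C c → D c →
                       Y.Comparable (new C C∈𝒞) (new D D∈𝒞)
  comparable-new-new {C} {D} C∈𝒞 D∈𝒞 Cc Dc = nested⇒Comparable C∈𝒞 D∈𝒞 nested
    where
    nested : C ⊆ D ⊎ D ⊆ C
    nested with downClosed-⊆-total (stemOf-downClosed D∈𝒞) (stemOf-downClosed C∈𝒞)
                                   (⊆Above D∈𝒞 Dc) (⊆Above C∈𝒞 Cc)
    ... | inj₁ S⊆S' =
      inj₁ (component-⊆ (isComponent C∈𝒞) (isComponent D∈𝒞) (Above-antitone S⊆S') Cc Dc)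
    ... | inj₂ S'⊆S =
      inj₂ (component-⊆ (isComponent D∈𝒞) (isComponent C∈𝒞) (Above-antitone S'⊆S) Dc Cc)

  <Y-linearBelow-old : ∀ c y z → y <Y old c → z <Y old c → Y.Comparable y z
  <Y-linearBelow-old c (old u)     (old v)     u<c v<c = proj₂ (proj₁ tree) c u v u<c v<c
  <Y-linearBelow-old c (old u)     (new D D∈𝒞) u<c Dc  = comparable-old-new D∈𝒞 (inj₁ u<c) Dc
  <Y-linearBelow-old c (new C C∈𝒞) (old v)     Cc v<c  = comparable-new-old C∈𝒞 (inj₁ v<c) Cc
  <Y-linearBelow-old c (new C C∈𝒞) (new D D∈𝒞) Cc Dc   = comparable-new-new C∈𝒞 D∈𝒞 Cc Dc

  <Y-linearBelow : ∀ x y z → y <Y x → z <Y x → Y.Comparable y z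
  <Y-linearBelow (old c) y z = <Y-linearBelow-old c y z
  <Y-linearBelow (new E E∈𝒞) y z y<E z<E with nonEmpty E∈𝒞
  ... | (e , Ee) = <Y-linearBelow-old e y z (<Y-trans {y} y<E Ee) (<Y-trans {z} z<E Ee)

  isForest : Y.IsForest
  isForest = <Y-isStrictPartialOrder , <Y-linearBelow

  module YF = ForestProperties {ℓ = a} {x = lsuc a ⊔ b} _≈Y_ _<Y_ isForest

  old-below : ∀ x → ∃ λ u → old u ≤Y x
  old-below (old u)       = u , inj₂ refl
  old-below (new C C∈𝒞) with stemOf-nonEmpty C∈𝒞
  ... | (s , Ss) = s , inj₁ (stemOf-<Y C∈𝒞 Ss)

  old-above : ∀ x → ∃ λ u → x ≤Y old u
  old-above (old u)       = u , inj₂ refl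
  old-above (new C C∈𝒞) with nonEmpty C∈𝒞
  ... | (c , Cc) = c , inj₁ Cc

  isTree : Y.IsTree
  isTree = isForest , commonLowerBound
    where
    commonLowerBound : ∀ x y → ∃ λ z → z ≤Y x × z ≤Y y
    commonLowerBound x y with old-below x | old-below y
    ... | (u , u≤x) | (v , v≤y) with proj₂ tree u v
    ...   | (w , w≤u , w≤v) =
      old w , YF.≤-trans {old w} {old u} {x} w≤u u≤x , YF.≤-trans {old w} {old v} {y} w≤v v≤y

  isSubstructure : IsSubstructureVia _<_ _≈Y_ _<Y_ embed
  isSubstructure = (λ _ _ → id) , λ _ _ → id , id

  -- Paths of the extension

  stemOf-⊃-point : ∀ {E F} (E∈𝒞 : In𝒞 E) (F∈𝒞 : In𝒞 F) → F ⊆ E → ¬ (E ⊆ F) →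
                   ∃ λ s → stemOf F∈𝒞 s × E s
  stemOf-⊃-point E∈𝒞 F∈𝒞 F⊆E E⊈F with nonEmpty F∈𝒞
  ... | (f , Ff) with em {P = stemOf F∈𝒞 ⊆ stemOf E∈𝒞}
  ...   | yes SF⊆SE =
    ⊥-elim (E⊈F (component-⊆ (isComponent E∈𝒞) (isComponent F∈𝒞) (Above-antitone SF⊆SE) (F⊆E Ff) Ff))
  ...   | no SF⊈SE with ¬⊆⇒∃ SF⊈SE
  ...     | (s , SFs , ¬SEs)
    with above-or-below (λ SEs' → ≤-below-comparable (⊆Above E∈𝒞 (F⊆E Ff) SEs') (⊆Above F∈𝒞 Ff SFs))
  ...       | inj₁ aboveSE =
    s , SFs , closed E∈𝒞 (F⊆E Ff) aboveSE aboveSE (⊆Above F∈𝒞 Ff SFs) ≤-refl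
  ...       | inj₂ (s' , SEs' , s<s') = ⊥-elim (¬SEs (stemOf-downClosed E∈𝒞 SEs' (inj₁ s<s')))

  OldPart : Pred Carrier (lsuc a ⊔ b) → Pred T a
  OldPart P u = Resize a (P (old u))

  module _ {P : Pred Carrier (lsuc a ⊔ b)} (pathP : Y.IsPath P) where

    path-∋-stemOf : ∀ {E} {E∈𝒞 : In𝒞 E} → P (new E E∈𝒞) → ∀ {s} → stemOf E∈𝒞 s → P (old s)
    path-∋-stemOf {E∈𝒞 = E∈𝒞} PE {s} Ss =
      YF.path-downClosed pathP {z = old s} PE (inj₁ (stemOf-<Y E∈𝒞 Ss))

    -- Otherwise P could be extended by any point of E.
    path-meets-component : ∀ {E} {E∈𝒞 : In𝒞 E} → P (new E E∈𝒞) → ∃ λ u → E u × P (old u)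
    path-meets-component {E} {E∈𝒞} PE with nonEmpty E∈𝒞
    ... | (e , Ee) = dne λ disjoint → disjoint (e , Ee , P∋e disjoint)
      where
      P∋e : ¬ (∃ λ u → E u × P (old u)) → P (old e)
      P∋e disjoint = YF.path-maximal pathP comparable
        where
        comparable : ∀ {w} → P w → Y.Comparable w (old e)
        comparable {w} Pw with YF.Comparable⇒≤⊎> (YF.path-comparable pathP Pw PE)
        ... | inj₁ w≤E = inj₁ (YF.≤-<-trans {w} {new E E∈𝒞} {old e} w≤E Ee)
        comparable {old u} Pu | inj₂ Eu = ⊥-elim (disjoint (u , Eu , Pu))
        comparable {new F F∈𝒞} PF | inj₂ (F⊆E , E⊈F) with stemOf-⊃-point E∈𝒞 F∈𝒞 F⊆E E⊈F
        ... | (s , SFs , Es) = ⊥-elim (disjoint (s , Es , path-∋-stemOf PF SFs))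

    new-comparable-old : ∀ {x} → (∀ {u} → P (old u) → Comparable u x) →
                         ∀ {E} {E∈𝒞 : In𝒞 E} → P (new E E∈𝒞) → Y.Comparable (new E E∈𝒞) (old x)
    new-comparable-old comparable {E} {E∈𝒞} PE
      with above-or-below (λ Ss → comparable (path-∋-stemOf PE Ss))
    ... | inj₂ (s , Ss , x<s) = inj₂ (inj₂ λ Ee → inj₁ (<-≤-trans x<s (⊆Above E∈𝒞 Ee Ss)))
    ... | inj₁ aboveS with path-meets-component PE
    ...   | (u , Eu , Pu) with Comparable⇒≤⊎> (comparable Pu)
    ...     | inj₁ u≤x = inj₁ (upClosed E∈𝒞 Eu u≤x)
    ...     | inj₂ x<u = inj₁ (closed E∈𝒞 Eu aboveS aboveS (inj₁ x<u) ≤-refl)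

    oldPart-isPath : IsPath (OldPart P)
    oldPart-isPath = (λ Px Py → YF.path-comparable pathP (unresize Px) (unresize Py)) , maximal
      where
      maximal : ∀ Q → IsChain Q → OldPart P ⊆ Q → Q ⊆ OldPart P
      maximal Q chainQ P⊆Q {x} Qx = resize (YF.path-maximal pathP comparable)
        where
        comparable-old : ∀ {u} → P (old u) → Comparable u x
        comparable-old Pu = chainQ (P⊆Q (resize Pu)) Qx
        comparable : ∀ {w} → P w → Y.Comparable w (old x)
        comparable {old _}   Pu = comparable-old Pu
        comparable {new _ _} PE = new-comparable-old comparable-old PE

  AboveY : Pred T a → Carrier → Set a
  AboveY L z = ∀ {l} → L l → old l ≤Y z

  aboveY-lowerBound : ∀ {L z x x'} → AboveY L z → z ≤Y old x → z ≤Y old x' →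
                      ∃ λ w → Above L w × w ≤ x × w ≤ x'
  aboveY-lowerBound {z = old w} L≤w w≤x w≤x' = w , L≤w , w≤x , w≤x'
  aboveY-lowerBound {L} {z = new E E∈𝒞} L≤E (inj₁ Ex) (inj₁ Ex')
    with component-connected (isComponent E∈𝒞) Ex Ex'
  ... | (w , aboveSw , w≤x , w≤x') = w , L≤w , w≤x , w≤x'
    where
    L≤w : Above L w
    L≤w Ll with L≤E Ll
    ... | inj₁ l≤E = l≤E (closed E∈𝒞 Ex aboveSw aboveSw w≤x ≤-refl)
  aboveY-lowerBound {z = new _ _} _ (inj₂ (lift ())) _
  aboveY-lowerBound {z = new _ _} _ (inj₁ _) (inj₂ (lift ()))

  componentOf-∋-aboveY : ∀ {L z z₀ x c₀} → AboveY L z → AboveY L z₀ → Y.Comparable z z₀ →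
                         z ≤Y old x → z₀ ≤Y old c₀ → ComponentOf (Above L) c₀ x
  componentOf-∋-aboveY {L} {z} {z₀} {x} {c₀} L≤z L≤z₀ z~z₀ z≤x z₀≤c₀ =
    (λ Ll → YF.≤-trans {old _} {z} {old x} (L≤z Ll) z≤x) , connected
    where
    connected : ∃ λ w → Above L w × w ≤ x × w ≤ c₀
    connected with YF.Comparable⇒≤⊎> z~z₀
    ... | inj₁ z≤z₀ =
      aboveY-lowerBound {L} {z} L≤z z≤x (YF.≤-trans {z} {z₀} {old c₀} z≤z₀ z₀≤c₀)
    ... | inj₂ z₀<z =
      aboveY-lowerBound {L} {z₀} L≤z₀ (YF.≤-trans {z₀} {z} {old x} (inj₁ z₀<z) z≤x) z₀≤c₀

  -- Infima along paths

  module Infimum {P A : Pred Carrier (lsuc a ⊔ b)} (pathP : Y.IsPath P) (A⊆P : A ⊆ P)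
                 {a₀} (Aa₀ : A a₀) {b₀} (b₀≤A : Y.LowerBound A b₀) where

    L : Pred T a
    L u = Resize a (Y.LowerBound A (old u))

    c₀ : T
    c₀ = proj₁ (old-above a₀)

    a₀≤c₀ : a₀ ≤Y old c₀
    a₀≤c₀ = proj₂ (old-above a₀)

    L≤c₀ : Above L c₀
    L≤c₀ {l} Ll = YF.≤-trans {old l} {a₀} {old c₀} (unresize Ll Aa₀) a₀≤c₀

    L-isStem : IsStem L
    L-isStem = downClosed-boundedAbove-isStem nonEmpty-L downClosed-L L≤c₀
      where
      nonEmpty-L : Satisfiable L
      nonEmpty-L with old-below b₀
      ... | (u , u≤b₀) = u , resize λ {x} Ax → YF.≤-trans {old u} {b₀} {x} u≤b₀ (b₀≤A Ax)
      downClosed-L : DownClosed L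
      downClosed-L {x} {y} Ly x≤y = resize λ {z} Az → YF.≤-trans {old x} {old y} {z} x≤y (unresize Ly Az)

    C : Pred T a
    C = ComponentOf (Above L) c₀

    C-isComponent : IsComponent (Above L) C
    C-isComponent = componentOf-isComponent {Above L} L≤c₀

    C-∋ : ∀ {x u} → A x → x ≤Y old u → C u
    C-∋ {x} Ax x≤u = componentOf-∋-aboveY {L} {x} {a₀}
      (λ Ll → unresize Ll Ax) (λ Ll → unresize Ll Aa₀)
      (YF.path-comparable pathP (A⊆P Ax) (A⊆P Aa₀)) x≤u a₀≤c₀

    lowerBound-⊇C : ∀ {E} (E∈𝒞 : In𝒞 E) → Y.LowerBound A (new E E∈𝒞) → C ⊆ E
    lowerBound-⊇C {E} E∈𝒞 E≤A =
      component-⊆ C-isComponent (isComponent E∈𝒞) (Above-antitone stem⊆L)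
                  (componentOf-∋ {Above L} L≤c₀) Ec₀
      where
      stem⊆L : stemOf E∈𝒞 ⊆ L
      stem⊆L Ss = resize λ {x} Ax →
        YF.≤-trans {old _} {new E E∈𝒞} {x} (inj₁ (stemOf-<Y E∈𝒞 Ss)) (E≤A Ax)
      Ec₀ : E c₀
      Ec₀ with YF.≤-trans {new E E∈𝒞} {a₀} {old c₀} (E≤A Aa₀) a₀≤c₀
      ... | inj₁ Ec₀ = Ec₀

    greatestLowerBound⇒infimum : ∀ {m} → Y.LowerBound A m →
                                 (∀ {m'} → P m' → Y.LowerBound A m' → m' ≤Y m) → Y.IsInfimumIn P A m
    greatestLowerBound⇒infimum {m} m≤A greatest =
      YF.path-downClosed pathP {z = m} (A⊆P Aa₀) (m≤A Aa₀) , m≤A , greatest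

    infimum-rooted : ∀ {r} → IsRoot C r → Y.IsInfimumIn P A (old r)
    infimum-rooted {r} (Cr , r≤C) = greatestLowerBound⇒infimum {old r} r≤A greatest
      where
      r≤A : Y.LowerBound A (old r)
      r≤A {old _}   Ax = r≤C (C-∋ Ax (inj₂ refl))
      r≤A {new _ _} Ax = inj₁ λ Ee → r≤C (C-∋ Ax (inj₁ Ee))
      greatest : ∀ {m'} → P m' → Y.LowerBound A m' → m' ≤Y old r
      greatest {old _}      _ u≤A = proj₁ Cr (resize λ {x} → u≤A {x})
      greatest {new E E∈𝒞} _ E≤A = inj₁ (lowerBound-⊇C E∈𝒞 E≤A Cr)

    infimum-rootless : (rootless : ¬ ∃ (IsRoot C)) (𝒴L : 𝒴 L) →
                       Y.IsInfimumIn P A (new C (L , 𝒴L , C-isComponent , rootless))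
    infimum-rootless rootless 𝒴L = greatestLowerBound⇒infimum {new C C∈𝒞} C≤A greatest
      where
      C∈𝒞 : In𝒞 C
      C∈𝒞 = L , 𝒴L , C-isComponent , rootless
      C≤A : Y.LowerBound A (new C C∈𝒞)
      C≤A {old _}      Ax = inj₁ (C-∋ Ax (inj₂ refl))
      C≤A {new E E∈𝒞} Ax = ⊆⇒≤Y C∈𝒞 E∈𝒞 λ Ee → C-∋ Ax (inj₁ Ee)
      greatest : ∀ {m'} → P m' → Y.LowerBound A m' → m' ≤Y new C C∈𝒞
      greatest {old _}      _ u≤A = inj₁ λ Cc → proj₁ Cc (resize λ {x} → u≤A {x})
      greatest {new E E∈𝒞} _ E≤A = ⊆⇒≤Y E∈𝒞 C∈𝒞 (lowerBound-⊇C E∈𝒞 E≤A)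

    infimum : 𝒴 L → ∃ (Y.IsInfimumIn P A)
    infimum 𝒴L with em {P = ∃ (IsRoot C)}
    ... | yes (r , root) = old r , infimum-rooted root
    ... | no rootless    = _ , infimum-rootless rootless 𝒴L

  pathwiseComplete : (∀ {S} → IsStem S → 𝒴 S) → Y.PathwiseComplete
  pathwiseComplete stems⊆𝒴 P pathP A A⊆P (a₀ , Aa₀) (b₀ , b₀≤A) =
    infimum (stems⊆𝒴 L-isStem)
    where open Infimum pathP A⊆P Aa₀ b₀≤A

  -- Suprema of intersections of paths

  module Supremum {P Q : Pred Carrier (lsuc a ⊔ b)} (pathP : Y.IsPath P) (pathQ : Y.IsPath Q)
                  {p₀} (Pp₀ : P p₀) (¬Qp₀ : ¬ Q p₀) {q₀} (Qq₀ : Q q₀)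
                  (noGreatest : ¬ ∃ λ m → (P ∩ Q) m × Y.UpperBound (P ∩ Q) m) where

    L : Pred T a
    L u = Resize a (P (old u) × Q (old u))

    P∩Q<P∖Q : ∀ {x y} → P x → Q x → P y → ¬ Q y → x <Y y
    P∩Q<P∖Q {x} {y} Px Qx Py ¬Qy with YF.Comparable⇒≤⊎> (YF.path-comparable pathP Py Px)
    ... | inj₁ y≤x = ⊥-elim (¬Qy (YF.path-downClosed pathQ {z = y} Qx y≤x))
    ... | inj₂ x<y = x<y

    P∩Q-unbounded : ∀ {x} → P x → Q x → ∃ λ y → (P y × Q y) × x <Y y
    P∩Q-unbounded {x} Px Qx
      with ¬⊆⇒∃ {P = P ∩ Q} {Q = _≤Y x} (λ x≥P∩Q → noGreatest (x , (Px , Qx) , x≥P∩Q))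
    ... | (y , (Py , Qy) , y≰x) with YF.Comparable⇒≤⊎> (YF.path-comparable pathP Py Px)
    ...   | inj₁ y≤x = ⊥-elim (y≰x y≤x)
    ...   | inj₂ x<y = y , (Py , Qy) , x<y

    upperBound-∉Q : ∀ {m} → P m → Y.UpperBound (P ∩ Q) m → ¬ Q m
    upperBound-∉Q Pm m≥P∩Q Qm = noGreatest (_ , (Pm , Qm) , m≥P∩Q)

    c₀ : T
    c₀ = proj₁ (old-above p₀)

    p₀≤c₀ : p₀ ≤Y old c₀
    p₀≤c₀ = proj₂ (old-above p₀)

    L<c₀ : ∀ {l} → L l → l < c₀
    L<c₀ {l} Ll with unresize Ll
    ... | (Pl , Ql) = YF.<-≤-trans {old l} {p₀} {old c₀} (P∩Q<P∖Q Pl Ql Pp₀ ¬Qp₀) p₀≤c₀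

    L≤c₀ : Above L c₀
    L≤c₀ Ll = inj₁ (L<c₀ Ll)

    L-isStem : IsStem L
    L-isStem = downClosed-boundedAbove-isStem nonEmpty-L downClosed-L L≤c₀
      where
      nonEmpty-L : Satisfiable L
      nonEmpty-L with proj₂ isTree p₀ q₀
      ... | (z , z≤p₀ , z≤q₀) with old-below z
      ...   | (u , u≤z) = u , resize
        ( YF.path-downClosed pathP {z = old u} (YF.path-downClosed pathP {z = z} Pp₀ z≤p₀) u≤z
        , YF.path-downClosed pathQ {z = old u} (YF.path-downClosed pathQ {z = z} Qq₀ z≤q₀) u≤z)
      downClosed-L : DownClosed L
      downClosed-L {x} Ly x≤y with unresize Ly
      ... | (Py , Qy) =
        resize (YF.path-downClosed pathP {z = old x} Py x≤y , YF.path-downClosed pathQ {z = old x} Qy x≤y)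

    P∖Q-aboveY : ∀ {y} → P y → ¬ Q y → AboveY L y
    P∖Q-aboveY Py ¬Qy Ll with unresize Ll
    ... | (Pl , Ql) = inj₁ (P∩Q<P∖Q Pl Ql Py ¬Qy)

    C : Pred T a
    C = ComponentOf (Above L) c₀

    C-isComponent : IsComponent (Above L) C
    C-isComponent = componentOf-isComponent {Above L} L≤c₀

    Cc₀ : C c₀
    Cc₀ = componentOf-∋ {Above L} L≤c₀

    C-∋ : ∀ {y x} → P y → ¬ Q y → y ≤Y old x → C x
    C-∋ {y} Py ¬Qy y≤x = componentOf-∋-aboveY {L} {y} {p₀}
      (P∖Q-aboveY Py ¬Qy) (P∖Q-aboveY Pp₀ ¬Qp₀) (YF.path-comparable pathP Py Pp₀) y≤x p₀≤c₀

    P∖Q-new-⊆C : ∀ {E} {E∈𝒞 : In𝒞 E} → P (new E E∈𝒞) → ¬ Q (new E E∈𝒞) → E ⊆ C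
    P∖Q-new-⊆C PE ¬QE Ee = C-∋ PE ¬QE (inj₁ Ee)

    P∩Q-new-⊇C : ∀ {F} {F∈𝒞 : In𝒞 F} → P (new F F∈𝒞) → Q (new F F∈𝒞) → C ⊆ F
    P∩Q-new-⊇C {F} {F∈𝒞} PF QF =
      component-⊆ C-isComponent (isComponent F∈𝒞) (Above-antitone stem⊆L) Cc₀ Fc₀
      where
      stem⊆L : stemOf F∈𝒞 ⊆ L
      stem⊆L Ss = resize (path-∋-stemOf pathP PF Ss , path-∋-stemOf pathQ QF Ss)
      Fc₀ : F c₀
      Fc₀ = YF.<-≤-trans {new F F∈𝒞} {p₀} {old c₀} (P∩Q<P∖Q PF QF Pp₀ ¬Qp₀) p₀≤c₀

    ∈P-belowc₀ : ∀ {m} → m ≤Y old c₀ → ¬ (p₀ <Y m) → P m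
    ∈P-belowc₀ {m} m≤c₀ p₀≮m
      with YF.Comparable⇒≤⊎> (YF.≤-below-comparable {old c₀} {m} {p₀} m≤c₀ p₀≤c₀)
    ... | inj₁ m≤p₀ = YF.path-downClosed pathP {z = m} Pp₀ m≤p₀
    ... | inj₂ p₀<m = ⊥-elim (p₀≮m p₀<m)

    leastOutsideQ⇒supremum : ∀ {m} → P m → ¬ Q m → (∀ {m'} → P m' → ¬ Q m' → m ≤Y m') →
                             Y.IsSupremumIn P (P ∩ Q) m
    leastOutsideQ⇒supremum Pm ¬Qm least =
      Pm , (λ (Px , Qx) → inj₁ (P∩Q<P∖Q Px Qx Pm ¬Qm)) ,
      λ Pm' m'≥P∩Q → least Pm' (upperBound-∉Q Pm' m'≥P∩Q)

    supremum-rooted : ∀ {r} → IsRoot C r → Y.IsSupremumIn P (P ∩ Q) (old r)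
    supremum-rooted {r} (Cr , r≤C) = leastOutsideQ⇒supremum Pr ¬Qr least
      where
      P∖Q≮r : ∀ {y} → P y → ¬ Q y → ¬ (y <Y old r)
      P∖Q≮r {old _}      Px ¬Qx x<r = ≤⇒≯ (r≤C (C-∋ Px ¬Qx (inj₂ refl))) x<r
      P∖Q≮r {new E E∈𝒞} PE ¬QE Er  = lowerBound-∉ E∈𝒞 Er λ Ee → r≤C (P∖Q-new-⊆C PE ¬QE Ee)
      Pr : P (old r)
      Pr = ∈P-belowc₀ {old r} (r≤C Cc₀) (P∖Q≮r Pp₀ ¬Qp₀)
      ¬Qr : ¬ Q (old r)
      ¬Qr Qr with P∩Q-unbounded Pr Qr
      ... | (old v , (Pv , Qv) , r<v)       = ≤⇒≯ (proj₁ Cr (resize (Pv , Qv))) r<v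
      ... | (new F F∈𝒞 , (PF , QF) , r≤F) = lowerBound-∉ F∈𝒞 (P∩Q-new-⊇C PF QF Cr) r≤F
      least : ∀ {m'} → P m' → ¬ Q m' → old r ≤Y m'
      least {old _}   Px ¬Qx = r≤C (C-∋ Px ¬Qx (inj₂ refl))
      least {new _ _} PE ¬QE = inj₁ λ Ee → r≤C (P∖Q-new-⊆C PE ¬QE Ee)

    supremum-rootless : (rootless : ¬ ∃ (IsRoot C)) (𝒴L : 𝒴 L) →
                        Y.IsSupremumIn P (P ∩ Q) (new C (L , 𝒴L , C-isComponent , rootless))
    supremum-rootless rootless 𝒴L = leastOutsideQ⇒supremum PC ¬QC least
      where
      C∈𝒞 : In𝒞 C
      C∈𝒞 = L , 𝒴L , C-isComponent , rootless
      P∖Q≮C : ∀ {y} → P y → ¬ Q y → ¬ (y <Y new C C∈𝒞)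
      P∖Q≮C {old x}   Px ¬Qx x≤C        = rootless (x , C-∋ Px ¬Qx (inj₂ refl) , x≤C)
      P∖Q≮C {new _ _} PE ¬QE (_ , E⊈C) = E⊈C (P∖Q-new-⊆C PE ¬QE)
      PC : P (new C C∈𝒞)
      PC = ∈P-belowc₀ {new C C∈𝒞} (inj₁ Cc₀) (P∖Q≮C Pp₀ ¬Qp₀)
      ¬QC : ¬ Q (new C C∈𝒞)
      ¬QC QC with P∩Q-unbounded PC QC
      ... | (old v , (Pv , Qv) , Cv)          = rootless (v , Cv , λ Cc → proj₁ Cc (resize (Pv , Qv)))
      ... | (new F F∈𝒞 , (PF , QF) , _ , C⊈F) = C⊈F (P∩Q-new-⊇C PF QF)
      least : ∀ {m'} → P m' → ¬ Q m' → new C C∈𝒞 ≤Y m'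
      least {old _}      Px ¬Qx = inj₁ (C-∋ Px ¬Qx (inj₂ refl))
      least {new E E∈𝒞} PE ¬QE = ⊆⇒≤Y C∈𝒞 E∈𝒞 (P∖Q-new-⊆C PE ¬QE)

    supremum : 𝒴 L → ∃ (Y.IsSupremumIn P (P ∩ Q))
    supremum 𝒴L with em {P = ∃ (IsRoot C)}
    ... | yes (r , root) = old r , supremum-rooted root
    ... | no rootless    = _ , supremum-rootless rootless 𝒴L

  distinctPaths-⊈ : ∀ {P Q} → Y.IsPath P → Y.IsPath Q → ¬ (P ⊆ Q × Q ⊆ P) → ∃ λ p → P p × ¬ Q p
  distinctPaths-⊈ pathP pathQ P≢Q = ¬⊆⇒∃ λ P⊆Q → P≢Q (P⊆Q , proj₂ pathP _ (proj₁ pathQ) P⊆Q)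

  weaklyBranchingComplete :
    (∀ {P Q L} → IsPath P → IsPath Q → (∀ x → (L x → P x × Q x) × (P x × Q x → L x)) → IsStem L → 𝒴 L) →
    Y.WeaklyBranchingComplete
  weaklyBranchingComplete pathMeetStems⊆𝒴 P Q pathP pathQ P≢Q =
    supremumIn pathP pathQ P≢Q , ∩-comm (supremumIn pathQ pathP (λ Q≐P → P≢Q (swap Q≐P)))
    where
    ∩-comm : ∃ (Y.IsSupremumIn Q (Q ∩ P)) → ∃ (Y.IsSupremumIn Q (P ∩ Q))
    ∩-comm (m , Qm , m≥Q∩P , least) =
      m , Qm , (λ P∩Qx → m≥Q∩P (swap P∩Qx)) , λ Qm' m'≥P∩Q → least Qm' (λ Q∩Px → m'≥P∩Q (swap Q∩Px))
    supremumIn : ∀ {P Q} → Y.IsPath P → Y.IsPath Q → ¬ (P ⊆ Q × Q ⊆ P) → ∃ (Y.IsSupremumIn P (P ∩ Q))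
    supremumIn {P} {Q} pathP pathQ P≢Q with em {P = ∃ λ m → (P ∩ Q) m × Y.UpperBound (P ∩ Q) m}
    ... | yes (m , P∩Qm , m≥P∩Q) = m , proj₁ P∩Qm , m≥P∩Q , λ _ m'≥P∩Q → m'≥P∩Q P∩Qm
    ... | no noGreatest
      with distinctPaths-⊈ pathP pathQ P≢Q | distinctPaths-⊈ pathQ pathP (λ Q≐P → P≢Q (swap Q≐P))
    ...   | (p₀ , Pp₀ , ¬Qp₀) | (q₀ , Qq₀ , _) =
      supremum (pathMeetStems⊆𝒴 (oldPart-isPath pathP) (oldPart-isPath pathQ) L≐ L-isStem)
      where
      open Supremum pathP pathQ Pp₀ ¬Qp₀ Qq₀ noGreatest
      L≐ : ∀ x → (L x → OldPart P x × OldPart Q x) × (OldPart P x × OldPart Q x → L x)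
      L≐ x = (λ Lx → resize (proj₁ (unresize Lx)) , resize (proj₂ (unresize Lx)))
           , (λ (Px , Qx) → resize (unresize Px , unresize Qx))

mainTheorem14 : (∀ {ℓ : Level} → ExcludedMiddle ℓ) →
    ∀ {a : Level} {T : Set a} (_<_ : Rel T a) → Order.IsTree _≡_ _<_ →
    (Order.IsTree (Extension._≈Y_ _<_ (TreeNotions.IsStem _<_)) (Extension._<Y_ _<_ (TreeNotions.IsStem _<_))
      × Order.PathwiseComplete (Extension._≈Y_ _<_ (TreeNotions.IsStem _<_)) (Extension._<Y_ _<_ (TreeNotions.IsStem _<_))
      × IsSubstructureVia _<_ (Extension._≈Y_ _<_ (TreeNotions.IsStem _<_)) (Extension._<Y_ _<_ (TreeNotions.IsStem _<_)) (Extension.embed _<_ (TreeNotions.IsStem _<_)))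
    × (Order.IsTree (Extension._≈Y_ _<_ (TreeNotions.IsFGTrunk _<_)) (Extension._<Y_ _<_ (TreeNotions.IsFGTrunk _<_))
      × Order.WeaklyBranchingComplete (Extension._≈Y_ _<_ (TreeNotions.IsFGTrunk _<_)) (Extension._<Y_ _<_ (TreeNotions.IsFGTrunk _<_))
      × IsSubstructureVia _<_ (Extension._≈Y_ _<_ (TreeNotions.IsFGTrunk _<_)) (Extension._<Y_ _<_ (TreeNotions.IsFGTrunk _<_)) (Extension.embed _<_ (TreeNotions.IsFGTrunk _<_)))
mainTheorem14 em _<_ tree =
  (Stems.isTree , Stems.pathwiseComplete id , Stems.isSubstructure) ,
  (Trunks.isTree , Trunks.weaklyBranchingComplete pathIntersectionStem-isFGTrunk , Trunks.isSubstructure)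
  where
  open TreeProperties em _<_ tree using (pathIntersectionStem-isFGTrunk)
  module Stems  = Extended em _<_ tree (TreeNotions.IsStem _<_) id
  module Trunks = Extended em _<_ tree (TreeNotions.IsFGTrunk _<_) (λ fgTrunk → proj₁ (proj₁ fgTrunk))
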